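{- Let $L \in \mathbb{Q} \setminus \{0,1\}$. If $L^2 - L + 1$ is the square of a rational number, then neither $L$ nor $1-L$ is the square of a rational number. -}

module Defs where

open import Data.Rational using (ℚ; _*_)
open import Relation.Binary.PropositionalEquality using (_≡_)
open import Data.Product using (∃)

IsSquare : ℚ → Set
IsSquare q = ∃ λ r → r * r ≡ q

module Submission where

-- If L = (n/d)² in lowest terms and L² − L + 1 = w², then (wd²)² = n⁴ − n²d² + d⁴ is an integer,
-- hence a square, so (|n|, d) is a coprime solution of x⁴ − x²y² + y⁴ = z²; the case 1 − L reduces
-- to this one because L ↦ 1 − L fixes L² − L + 1. By a classical result of Euler and Pocklington
-- such solutions have x = 0 or x = y, that is L = 0 or L = 1. For x and y of opposite parity this
-- is Fermat descent: (2z)² = (2x² − y²)² + 3y⁴ factors as A·B = 3y⁴ with A + B = 4z and A, B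
-- coprime; 3 ∣ B is impossible modulo 8, and 3 ∣ A yields, through a Pythagorean triple, a solution
-- of opposite parity with smaller z. For x > y both odd, writing x = s + t, y = s − t, the equation
-- z² = (s² + t²)² + 12s²t² is factored again; with the four-number lemma this ends in a contradiction
-- modulo 4 or 8, or in coprime a, c with a² + c² and a² + 4c² both squares, which again gives a
-- solution of opposite parity.

open import Defs
open import Data.Nat.Coprimality using (Coprime; coprime-divisor; coprime⇒gcd≡1; gcd≡1⇒coprime; recompute; 1-coprimeTo; 0-coprimeTo-m⇒m≡1)
import Data.Nat.Coprimality as Coprime
open import Data.Product using (∃; ∃₂; ∃-syntax; _×_; _,_; proj₁; proj₂)
open import Data.Sum using (_⊎_; inj₁; inj₂)
open import Data.Empty using (⊥; ⊥-elim)
open import Relation.Binary.PropositionalEquality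
open import Relation.Nullary using (¬_; yes; no; contradiction)
open import Function using (case_of_)

module QuarticEquation where

  open import Data.Nat using (ℕ; zero; suc; _+_; _*_; _∸_; _≤_; _<_; z≤n; s≤s; _%_; NonZero; ≢-nonZero; >-nonZero)
  open import Data.Nat.Properties
  open import Data.Nat.Divisibility
  open import Data.Nat.GCD using (gcd; gcd[m,n]≡0⇒m≡0; gcd[m,n]∣m; gcd[m,n]∣n; gcd-greatest; c*gcd[m,n]≡gcd[cm,cn])
  open import Data.Nat.DivMod using ([m+kn]%n≡m%n)
  open import Data.Nat.Primality using (Prime; prime?; euclidsLemma)
  open import Data.Nat.Induction using (<-rec)
  open import Data.Nat.Tactic.RingSolver using (solve-∀)
  open import Relation.Binary.Definitions using (tri<; tri≈; tri>)
  open import Relation.Nullary.Decidable using (from-yes)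

  infixl 8 _²

  _² : ℕ → ℕ
  n ² = n * n

  ²-mono-< : ∀ {m n} → m < n → m ² < n ²
  ²-mono-< m<n = *-mono-< m<n m<n

  ²-mono-≤ : ∀ {m n} → m ≤ n → m ² ≤ n ²
  ²-mono-≤ m≤n = *-mono-≤ m≤n m≤n

  ²-cancel-≤ : ∀ {m n} → m ² ≤ n ² → m ≤ n
  ²-cancel-≤ {m} {n} m²≤n² with m ≤? n
  ... | yes m≤n = m≤n
  ... | no m≰n = contradiction m²≤n² (<⇒≱ (²-mono-< (≰⇒> m≰n)))

  ²-cancel-< : ∀ {m n} → m ² < n ² → m < n
  ²-cancel-< {m} {n} m²<n² with m <? n
  ... | yes m<n = m<n
  ... | no m≮n = contradiction m²<n² (≤⇒≯ (²-mono-≤ (≮⇒≥ m≮n)))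

  ²-injective : ∀ {m n} → m ² ≡ n ² → m ≡ n
  ²-injective eq = ≤-antisym (²-cancel-≤ (≤-reflexive eq)) (²-cancel-≤ (≤-reflexive (sym eq)))

  *-² : ∀ m n → (m * n) ² ≡ m ² * n ²
  *-² = lemma
    where
    lemma : ∀ m n → (m * n) * (m * n) ≡ (m * m) * (n * n)
    lemma = solve-∀

  n≤n² : ∀ n → n ≤ n ²
  n≤n² zero    = z≤n
  n≤n² (suc n) = m≤m*n (suc n) (suc n)

  n<n² : ∀ {n} → 1 < n → n < n ²
  n<n² {suc zero}    (s≤s ())
  n<n² {suc (suc n)} _ = m<m*n (suc (suc n)) (suc (suc n)) (s≤s (s≤s z≤n))

  m*n>0⇒m>0 : ∀ m n → 0 < m * n → 0 < m
  m*n>0⇒m>0 (suc _) _ _ = s≤s z≤n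

  m*n>0⇒n>0 : ∀ m n → 0 < m * n → 0 < n
  m*n>0⇒n>0 m n 0<mn = m*n>0⇒m>0 n m (subst (0 <_) (*-comm m n) 0<mn)

  Even Odd : ℕ → Set
  Even n = ∃[ k ] n ≡ k + k
  Odd  n = ∃[ k ] n ≡ suc (k + k)

  even-or-odd : ∀ n → Even n ⊎ Odd n
  even-or-odd zero = inj₁ (0 , refl)
  even-or-odd (suc n) with even-or-odd n
  ... | inj₁ (k , refl) = inj₂ (k , refl)
  ... | inj₂ (k , refl) = inj₁ (suc k , cong suc (sym (+-suc k k)))

  residue-cong : ∀ n .{{_ : NonZero n}} {r s} i j → r + i * n ≡ s + j * n → r % n ≡ s % n
  residue-cong n {r} {s} i j eq = begin
    r % n           ≡⟨ [m+kn]%n≡m%n r i n ⟨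
    (r + i * n) % n ≡⟨ cong (_% n) eq ⟩
    (s + j * n) % n ≡⟨ [m+kn]%n≡m%n s j n ⟩
    s % n           ∎
    where open ≡-Reasoning

  even⇒¬odd : ∀ {n} → Even n → ¬ Odd n
  even⇒¬odd {n} (k , refl) (j , eq) = case residue-cong 2 k j (trans (lemma₁ k) (trans eq (lemma₂ j))) of λ ()
    where
    lemma₁ : ∀ k → 0 + k * 2 ≡ k + k
    lemma₁ = solve-∀
    lemma₂ : ∀ j → suc (j + j) ≡ 1 + j * 2
    lemma₂ = solve-∀

  ¬even⇒odd : ∀ {n} → ¬ Even n → Odd n
  ¬even⇒odd {n} ¬even with even-or-odd n
  ... | inj₁ even = contradiction even ¬even
  ... | inj₂ odd  = odd

  odd⇒>0 : ∀ {n} → Odd n → 0 < n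
  odd⇒>0 (k , refl) = s≤s z≤n

  even-*ʳ : ∀ {m} n → Even m → Even (m * n)
  even-*ʳ n (k , refl) = k * n , lemma k n
    where
    lemma : ∀ k n → (k + k) * n ≡ k * n + k * n
    lemma = solve-∀

  even-*ˡ : ∀ m {n} → Even n → Even (m * n)
  even-*ˡ m {n} even = subst Even (*-comm n m) (even-*ʳ m even)

  odd-* : ∀ {m n} → Odd m → Odd n → Odd (m * n)
  odd-* (i , refl) (j , refl) = i + j + 2 * (i * j) , lemma i j
    where
    lemma : ∀ i j → suc (i + i) * suc (j + j) ≡ suc ((i + j + 2 * (i * j)) + (i + j + 2 * (i * j)))
    lemma = solve-∀

  odd-*⇒odd : ∀ m n → Odd (m * n) → Odd m × Odd n
  odd-*⇒odd m n odd =
    ¬even⇒odd (λ even → even⇒¬odd (even-*ʳ n even) odd) ,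
    ¬even⇒odd (λ even → even⇒¬odd (even-*ˡ m even) odd)

  even+even⇒even : ∀ {m n} → Even m → Even n → Even (m + n)
  even+even⇒even (i , refl) (j , refl) = i + j , lemma i j
    where
    lemma : ∀ i j → (i + i) + (j + j) ≡ (i + j) + (i + j)
    lemma = solve-∀

  odd+odd⇒even : ∀ {m n} → Odd m → Odd n → Even (m + n)
  odd+odd⇒even (i , refl) (j , refl) = suc (i + j) , lemma i j
    where
    lemma : ∀ i j → suc (i + i) + suc (j + j) ≡ suc (i + j) + suc (i + j)
    lemma = solve-∀

  odd+even⇒odd : ∀ {m n} → Odd m → Even n → Odd (m + n)
  odd+even⇒odd (i , refl) (j , refl) = i + j , lemma i j
    where
    lemma : ∀ i j → suc (i + i) + (j + j) ≡ suc ((i + j) + (i + j))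
    lemma = solve-∀

  even⇒2∣ : ∀ {n} → Even n → 2 ∣ n
  even⇒2∣ (k , refl) = divides k (lemma k)
    where
    lemma : ∀ k → k + k ≡ k * 2
    lemma = solve-∀

  2∣⇒even : ∀ {n} → 2 ∣ n → Even n
  2∣⇒even (divides k refl) = k , lemma k
    where
    lemma : ∀ k → k * 2 ≡ k + k
    lemma = solve-∀

  even-² : ∀ {n} → Even n → ∃[ k ] n ² ≡ k * 4
  even-² (k , refl) = k * k , lemma k
    where
    lemma : ∀ k → (k + k) * (k + k) ≡ k * k * 4
    lemma = solve-∀

  even-²⁻¹ : ∀ {n} → Even (n ²) → Even n
  even-²⁻¹ {n} even with even-or-odd n
  ... | inj₁ even-n = even-n
  ... | inj₂ odd-n  = ⊥-elim (even⇒¬odd even (odd-* odd-n odd-n))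

  odd-² : ∀ {n} → Odd n → ∃[ k ] n ² ≡ 1 + k * 8
  odd-² (k , refl) with even-or-odd k
  ... | inj₁ (m , refl) = m * m + m * m + m , lemma m
    where
    lemma : ∀ m → suc (m + m + (m + m)) * suc (m + m + (m + m)) ≡ 1 + (m * m + m * m + m) * 8
    lemma = solve-∀
  ... | inj₂ (m , refl) = m * m + m * m + 3 * m + 1 , lemma m
    where
    lemma : ∀ m → suc (suc (m + m) + suc (m + m)) * suc (suc (m + m) + suc (m + m)) ≡ 1 + (m * m + m * m + 3 * m + 1) * 8
    lemma = solve-∀

  2+4k≢² : ∀ k n → 2 + k * 4 ≢ n ²
  2+4k≢² k n eq with even-or-odd n
  ... | inj₁ even = let (r , n²≡4r) = even-² even in
    case residue-cong 4 k r (trans eq n²≡4r) of λ ()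
  ... | inj₂ odd  = let (r , n²≡1+8r) = odd-² odd in
    case residue-cong 4 k (2 * r) (trans eq (trans n²≡1+8r (cong suc (lemma r)))) of λ ()
    where
    lemma : ∀ r → r * 8 ≡ 2 * r * 4
    lemma = solve-∀

  OppositeParity : ℕ → ℕ → Set
  OppositeParity m n = (Even m × Odd n) ⊎ (Odd m × Even n)

  odd-+⇒opposite-parity : ∀ {m n} → Odd (m + n) → OppositeParity m n
  odd-+⇒opposite-parity {m} {n} odd with even-or-odd m | even-or-odd n
  ... | inj₁ even-m | inj₁ even-n = ⊥-elim (even⇒¬odd (even+even⇒even even-m even-n) odd)
  ... | inj₁ even-m | inj₂ odd-n  = inj₁ (even-m , odd-n)
  ... | inj₂ odd-m  | inj₁ even-n = inj₂ (odd-m , even-n)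
  ... | inj₂ odd-m  | inj₂ odd-n  = ⊥-elim (even⇒¬odd (odd+odd⇒even odd-m odd-n) odd)

  odd+²≡²⇒opposite-parity : ∀ {a p q} → Odd a → a + q ² ≡ p ² → OppositeParity p q
  odd+²≡²⇒opposite-parity {a} {p} {q} odd-a a+q²≡p² with even-or-odd p | even-or-odd q
  ... | inj₁ even-p | inj₁ even-q =
    ⊥-elim (even⇒¬odd (even-*ʳ p even-p) (subst Odd a+q²≡p² (odd+even⇒odd odd-a (even-*ʳ q even-q))))
  ... | inj₁ even-p | inj₂ odd-q  = inj₁ (even-p , odd-q)
  ... | inj₂ odd-p  | inj₁ even-q = inj₂ (odd-p , even-q)
  ... | inj₂ odd-p  | inj₂ odd-q  =
    ⊥-elim (even⇒¬odd (subst Even a+q²≡p² (odd+odd⇒even odd-a (odd-* odd-q odd-q))) (odd-* odd-p odd-p))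

  opposite-parity⇒even-* : ∀ {m n} → OppositeParity m n → Even (m * n)
  opposite-parity⇒even-* {m} {n} (inj₁ (even-m , _)) = even-*ʳ n even-m
  opposite-parity⇒even-* {m} {n} (inj₂ (_ , even-n)) = even-*ˡ m even-n

  opposite-parity⇒²+²≡1+4r : ∀ {m n} → OppositeParity m n → ∃[ r ] m ² + n ² ≡ 1 + r * 4
  opposite-parity⇒²+²≡1+4r {m} {n} (inj₁ (even-m , odd-n)) =
    let (i , m²≡4i) = even-² even-m
        (j , n²≡1+8j) = odd-² odd-n
    in i + j * 2 , trans (cong₂ _+_ m²≡4i n²≡1+8j) (lemma i j)
    where
    lemma : ∀ i j → i * 4 + (1 + j * 8) ≡ 1 + (i + j * 2) * 4
    lemma = solve-∀
  opposite-parity⇒²+²≡1+4r {m} {n} (inj₂ (odd-m , even-n)) =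
    let (i , n²≡4i) = even-² even-n
        (j , m²≡1+8j) = odd-² odd-m
    in i + j * 2 , trans (cong₂ _+_ m²≡1+8j n²≡4i) (lemma i j)
    where
    lemma : ∀ i j → (1 + j * 8) + i * 4 ≡ 1 + (i + j * 2) * 4
    lemma = solve-∀

  coprime-∣ˡ : ∀ {m n d} → Coprime m n → d ∣ m → Coprime d n
  coprime-∣ˡ coprime d∣m (e∣d , e∣n) = coprime (∣-trans e∣d d∣m , e∣n)

  coprime-∣ʳ : ∀ {m n d} → Coprime m n → d ∣ n → Coprime m d
  coprime-∣ʳ coprime d∣n = Coprime.sym (coprime-∣ˡ (Coprime.sym coprime) d∣n)

  coprime-*ˡ : ∀ {m n o} → Coprime m o → Coprime n o → Coprime (m * n) o
  coprime-*ˡ {m} m⊥o n⊥o {d} (d∣mn , d∣o) = n⊥o (coprime-divisor d⊥m d∣mn , d∣o)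
    where
    d⊥m : Coprime d m
    d⊥m (e∣d , e∣m) = m⊥o (e∣m , ∣-trans e∣d d∣o)

  coprime-*ʳ : ∀ {m n o} → Coprime m n → Coprime m o → Coprime m (n * o)
  coprime-*ʳ m⊥n m⊥o = Coprime.sym (coprime-*ˡ (Coprime.sym m⊥n) (Coprime.sym m⊥o))

  coprime-² : ∀ {m n} → Coprime m n → Coprime (m ²) (n ²)
  coprime-² m⊥n = coprime-*ʳ m²⊥n m²⊥n
    where
    m²⊥n = coprime-*ˡ m⊥n m⊥n

  coprime-²⁻¹ : ∀ {m n} → Coprime (m ²) (n ²) → Coprime m n
  coprime-²⁻¹ {m} {n} m²⊥n² (d∣m , d∣n) = m²⊥n² (∣m⇒∣m*n m d∣m , ∣m⇒∣m*n n d∣n)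

  ∣²+²⇒coprime : ∀ {m n d} → Coprime m n → d ∣ m ² + n ² → Coprime d m
  ∣²+²⇒coprime {m} {n} m⊥n d∣m²+n² (e∣d , e∣m) =
    coprime-*ʳ m⊥n m⊥n (e∣m , ∣m+n∣m⇒∣n (∣-trans e∣d d∣m²+n²) (∣m⇒∣m*n m e∣m))

  coprime⇒¬even∧even : ∀ {m n} → Coprime m n → Even m → ¬ Even n
  coprime⇒¬even∧even m⊥n even-m even-n = case m⊥n (even⇒2∣ even-m , even⇒2∣ even-n) of λ ()

  ∣odd⇒coprime-2 : ∀ {n d} → Odd n → d ∣ n → Coprime d 2
  ∣odd⇒coprime-2 odd d∣n {0} (_ , 0∣2) = case 0∣⇒≡0 0∣2 of λ ()
  ∣odd⇒coprime-2 odd d∣n {1} _ = refl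
  ∣odd⇒coprime-2 odd d∣n {2} (2∣d , _) = contradiction odd (even⇒¬odd (2∣⇒even (∣-trans 2∣d d∣n)))
  ∣odd⇒coprime-2 odd d∣n {suc (suc (suc _))} (_ , e∣2) with ∣⇒≤ e∣2
  ... | s≤s (s≤s ())

  ∣4⇒≡1∨≡2∨≡4 : ∀ {d} → d ∣ 4 → d ≡ 1 ⊎ d ≡ 2 ⊎ d ≡ 4
  ∣4⇒≡1∨≡2∨≡4 {0} 0∣4 = case 0∣⇒≡0 0∣4 of λ ()
  ∣4⇒≡1∨≡2∨≡4 {1} _ = inj₁ refl
  ∣4⇒≡1∨≡2∨≡4 {2} _ = inj₂ (inj₁ refl)
  ∣4⇒≡1∨≡2∨≡4 {3} 3∣4 = case n∣m⇒m%n≡0 4 3 3∣4 of λ ()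
  ∣4⇒≡1∨≡2∨≡4 {4} _ = inj₂ (inj₂ refl)
  ∣4⇒≡1∨≡2∨≡4 {suc (suc (suc (suc (suc d))))} d∣4 with ∣⇒≤ d∣4
  ... | s≤s (s≤s (s≤s (s≤s ())))

  ∣4*²∧∣4*²⇒∣4 : ∀ {k m n} → k ∣ 4 * m ² → k ∣ 4 * n ² → Coprime m n → k ∣ 4
  ∣4*²∧∣4*²⇒∣4 {k} {m} {n} k∣4m² k∣4n² m⊥n = subst (k ∣_) 4*gcd≡4 (gcd-greatest k∣4m² k∣4n²)
    where
    4*gcd≡4 : gcd (4 * m ²) (4 * n ²) ≡ 4
    4*gcd≡4 = begin
      gcd (4 * m ²) (4 * n ²) ≡⟨ c*gcd[m,n]≡gcd[cm,cn] 4 (m ²) (n ²) ⟨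
      4 * gcd (m ²) (n ²)     ≡⟨ cong (4 *_) (coprime⇒gcd≡1 (coprime-² m⊥n)) ⟩
      4                       ∎
      where open ≡-Reasoning

  d²∣3⇒d≡1 : ∀ {d} → d ² ∣ 3 → d ≡ 1
  d²∣3⇒d≡1 {zero}        d²∣3 = case 0∣⇒≡0 d²∣3 of λ ()
  d²∣3⇒d≡1 {suc zero}    _    = refl
  d²∣3⇒d≡1 {suc (suc d)} d²∣3 = contradiction (∣⇒≤ d²∣3) (<⇒≱ (²-mono-≤ {2} (s≤s (s≤s z≤n))))

  *≡3*²⇒coprime : ∀ {m n c} → m * n ≡ 3 * c ² → (∀ {d} → d ∣ m → d ∣ n → Coprime d c) → Coprime m n
  *≡3*²⇒coprime {m} {n} {c} mn≡3c² common⊥c {d} (d∣m , d∣n) =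
    d²∣3⇒d≡1 (coprime-divisor (coprime-² (common⊥c d∣m d∣n))
      (subst (d ² ∣_) (trans mn≡3c² (*-comm 3 (c ²))) (*-pres-∣ d∣m d∣n)))

  -- Existence lemmas marked opaque are used only through their statements: unfolding
  -- their witnesses during later unification makes type checking very slow.
  opaque
    coprime-*≡²⇒²ˡ : ∀ {m n c} → Coprime m n → m * n ≡ c ² → ∃[ r ] m ≡ r ²
    coprime-*≡²⇒²ˡ {m} {n} {c} m⊥n mn≡c² = g , ∣-antisym m∣g² g²∣m
      where
      g : ℕ
      g = gcd m c
      g∣m : g ∣ m
      g∣m = gcd[m,n]∣m m c
      g∣c : g ∣ c
      g∣c = gcd[m,n]∣n m c
      m∣cg : m ∣ c * g
      m∣cg = subst (m ∣_) (sym (c*gcd[m,n]≡gcd[cm,cn] c m c))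
               (gcd-greatest (n∣m*n c) (subst (m ∣_) mn≡c² (m∣m*n n)))
      m∣g² : m ∣ g * g
      m∣g² = subst (m ∣_) (sym (c*gcd[m,n]≡gcd[cm,cn] g m c))
               (gcd-greatest (n∣m*n g) (subst (m ∣_) (*-comm c g) m∣cg))
      g²∣m : g * g ∣ m
      g²∣m = coprime-divisor (coprime-*ˡ g⊥n g⊥n)
               (subst (g * g ∣_) (trans (sym mn≡c²) (*-comm m n)) (*-pres-∣ g∣c g∣c))
        where
        g⊥n : Coprime g n
        g⊥n = coprime-∣ˡ m⊥n g∣m

  coprime-*≡²⇒² : ∀ {m n c} → Coprime m n → m * n ≡ c ² →
                  ∃₂ λ r s → m ≡ r ² × n ≡ s ² × c ≡ r * s × Coprime r s
  coprime-*≡²⇒² {m} {n} {c} m⊥n mn≡c² = r , s , m≡r² , n≡s² , c≡rs , r⊥s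
    where
    r = proj₁ (coprime-*≡²⇒²ˡ {c = c} m⊥n mn≡c²)
    m≡r² = proj₂ (coprime-*≡²⇒²ˡ {c = c} m⊥n mn≡c²)
    s = proj₁ (coprime-*≡²⇒²ˡ {c = c} (Coprime.sym m⊥n) (trans (*-comm n m) mn≡c²))
    n≡s² = proj₂ (coprime-*≡²⇒²ˡ {c = c} (Coprime.sym m⊥n) (trans (*-comm n m) mn≡c²))
    c≡rs : c ≡ r * s
    c≡rs = ²-injective (begin
      c ²         ≡⟨ mn≡c² ⟨
      m * n       ≡⟨ cong₂ _*_ m≡r² n≡s² ⟩
      r ² * s ²   ≡⟨ *-² r s ⟨
      (r * s) ²   ∎)
      where open ≡-Reasoning
    r⊥s : Coprime r s
    r⊥s = coprime-²⁻¹ (subst₂ Coprime m≡r² n≡s² m⊥n)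

  coprime-*≡3*²⇒3*²×² : ∀ {m n c} → Coprime m n → m * n ≡ 3 * c ² → 3 ∣ m →
                        ∃₂ λ a b → m ≡ 3 * a ² × n ≡ b ² × c ≡ a * b × Coprime a b
  coprime-*≡3*²⇒3*²×² {m} {n} {c} m⊥n mn≡3c² (divides k refl) =
    let (a , b , k≡a² , n≡b² , c≡ab , a⊥b) = coprime-*≡²⇒² k⊥n kn≡c²
    in a , b , trans (*-comm k 3) (cong (3 *_) k≡a²) , n≡b² , c≡ab , a⊥b
    where
    k⊥n : Coprime k n
    k⊥n = coprime-∣ˡ m⊥n (m∣m*n 3)
    kn≡c² : k * n ≡ c ²
    kn≡c² = *-cancelˡ-≡ _ _ 3 (trans (lemma k n) mn≡3c²)
      where
      lemma : ∀ k n → 3 * (k * n) ≡ k * 3 * n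
      lemma = solve-∀

  opaque
    coprime-*≡3*⁴⇒3*⁴×⁴ : ∀ {m n y} → Coprime m n → m * n ≡ 3 * y ² ² → 3 ∣ m →
                          ∃₂ λ a b → m ≡ 3 * a ² ² × n ≡ b ² ² × y ≡ a * b × Coprime a b
    coprime-*≡3*⁴⇒3*⁴×⁴ {y = y} m⊥n mn≡3y⁴ 3∣m =
      let (a′ , b′ , m≡3a′² , n≡b′² , y²≡a′b′ , a′⊥b′) = coprime-*≡3*²⇒3*²×² m⊥n mn≡3y⁴ 3∣m
          (a , b , a′≡a² , b′≡b² , y≡ab , a⊥b) = coprime-*≡²⇒² {c = y} a′⊥b′ (sym y²≡a′b′)
      in a , b , trans m≡3a′² (cong (λ a′ → 3 * a′ ²) a′≡a²) , trans n≡b′² (cong _² b′≡b²) ,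
         y≡ab , a⊥b

  opaque
    difference-of-squares : ∀ m d {k} → m ² ≡ d ² + k → ∃[ u ] m ≡ d + u × u * (u + 2 * d) ≡ k
    difference-of-squares m d {k} m²≡d²+k = u , sym d+u≡m , +-cancelˡ-≡ (d ²) _ _ (begin
      d ² + u * (u + 2 * d) ≡⟨ lemma d u ⟨
      (d + u) ²             ≡⟨ cong _² d+u≡m ⟩
      m ²                   ≡⟨ m²≡d²+k ⟩
      d ² + k               ∎)
      where
      open ≡-Reasoning
      d≤m : d ≤ m
      d≤m = ²-cancel-≤ (subst (d ² ≤_) (sym m²≡d²+k) (m≤m+n (d ²) k))
      u : ℕ
      u = proj₁ (m≤n⇒∃[o]m+o≡n d≤m)
      d+u≡m : d + u ≡ m
      d+u≡m = proj₂ (m≤n⇒∃[o]m+o≡n d≤m)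
      lemma : ∀ d u → (d + u) * (d + u) ≡ d * d + u * (u + 2 * d)
      lemma = solve-∀

  four-number-lemma : ∀ {α β s t} → α * β ≡ s * t → 0 < α → 0 < s →
    ∃₂ λ e f → ∃₂ λ g h → α ≡ e * g × s ≡ e * f × β ≡ f * h × t ≡ g * h
  four-number-lemma {α} {β} {s} {t} αβ≡st 0<α 0<s = e , f , g , h , α≡eg , s≡ef , β≡fh , t≡gh
    where
    open ≡-Reasoning
    e = gcd α s
    g = quotient (gcd[m,n]∣m α s)
    f = quotient (gcd[m,n]∣n α s)
    α≡eg : α ≡ e * g
    α≡eg = trans (m∣n⇒n≡quotient*m (gcd[m,n]∣m α s)) (*-comm g e)
    s≡ef : s ≡ e * f
    s≡ef = trans (m∣n⇒n≡quotient*m (gcd[m,n]∣n α s)) (*-comm f e)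
    instance
      e≢0 : NonZero e
      e≢0 = ≢-nonZero (λ e≡0 → <-irrefl (sym (gcd[m,n]≡0⇒m≡0 e≡0)) 0<α)
      f≢0 : NonZero f
      f≢0 = ≢-nonZero (λ f≡0 → <-irrefl (sym (trans s≡ef (trans (cong (e *_) f≡0) (*-zeroʳ e)))) 0<s)
    g⊥f : Coprime g f
    g⊥f = gcd≡1⇒coprime (*-cancelˡ-≡ _ _ e (begin
      e * gcd g f         ≡⟨ c*gcd[m,n]≡gcd[cm,cn] e g f ⟩
      gcd (e * g) (e * f) ≡⟨ cong₂ gcd α≡eg s≡ef ⟨
      gcd α s             ≡⟨ *-identityʳ e ⟨
      e * 1               ∎))
    gβ≡ft : g * β ≡ f * t
    gβ≡ft = *-cancelˡ-≡ _ _ e (begin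
      e * (g * β) ≡⟨ *-assoc e g β ⟨
      e * g * β   ≡⟨ cong (_* β) α≡eg ⟨
      α * β       ≡⟨ αβ≡st ⟩
      s * t       ≡⟨ cong (_* t) s≡ef ⟩
      e * f * t   ≡⟨ *-assoc e f t ⟩
      e * (f * t) ∎)
    f∣β : f ∣ β
    f∣β = coprime-divisor (Coprime.sym g⊥f) (divides t (trans gβ≡ft (*-comm f t)))
    h = quotient f∣β
    β≡fh : β ≡ f * h
    β≡fh = m∣n⇒n≡m*quotient f∣β
    t≡gh : t ≡ g * h
    t≡gh = *-cancelˡ-≡ _ _ f (begin
      f * t       ≡⟨ gβ≡ft ⟨
      g * β       ≡⟨ cong (g *_) β≡fh ⟩
      g * (f * h) ≡⟨ lemma g f h ⟩
      f * (g * h) ∎)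
      where
      lemma : ∀ g f h → g * (f * h) ≡ f * (g * h)
      lemma = solve-∀

  opaque
    pythagorean-triple : ∀ {x k z} → x ² + 4 * k ² ≡ z ² → Coprime x k → Odd x →
      ∃₂ λ p q → x + q ² ≡ p ² × k ≡ p * q × Coprime p q × OppositeParity p q
    pythagorean-triple {x} {k} {z} x²+4k²≡z² x⊥k odd-x =
      let (q , p , v≡q² , x+v≡p² , k≡qp , q⊥p) = coprime-*≡²⇒² v⊥x+v v[x+v]≡k²
          x+q²≡p² = trans (cong (x +_) (sym v≡q²)) x+v≡p²
          p⊥q = Coprime.sym q⊥p
      in p , q , x+q²≡p² , trans k≡qp (*-comm q p) , p⊥q , odd+²≡²⇒opposite-parity odd-x x+q²≡p²
      where
      open ≡-Reasoning
      w : ℕ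
      w = proj₁ (difference-of-squares z x (sym x²+4k²≡z²))
      w[w+2x]≡4k² : w * (w + 2 * x) ≡ 4 * k ²
      w[w+2x]≡4k² = proj₂ (proj₂ (difference-of-squares z x (sym x²+4k²≡z²)))
      even-w : Even w
      even-w with even-or-odd w
      ... | inj₁ even = even
      ... | inj₂ odd  = ⊥-elim (even⇒¬odd (subst Even (sym w[w+2x]≡4k²) (even-*ʳ (k ²) (2 , refl)))
                                   (odd-* odd (odd+even⇒odd odd (even-*ʳ x (1 , refl)))))
      v : ℕ
      v = proj₁ even-w
      v[x+v]≡k² : v * (x + v) ≡ k ²
      v[x+v]≡k² = *-cancelˡ-≡ _ _ 4 (begin
        4 * (v * (x + v))       ≡⟨ lemma v x ⟩
        (v + v) * ((v + v) + 2 * x) ≡⟨ cong (λ w → w * (w + 2 * x)) (proj₂ even-w) ⟨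
        w * (w + 2 * x)         ≡⟨ w[w+2x]≡4k² ⟩
        4 * k ²                 ∎)
        where
        lemma : ∀ v x → 4 * (v * (x + v)) ≡ (v + v) * ((v + v) + 2 * x)
        lemma = solve-∀
      v⊥x+v : Coprime v (x + v)
      v⊥x+v {d} (d∣v , d∣x+v) = coprime-*ʳ x⊥k x⊥k (d∣x , d∣k²)
        where
        d∣x : d ∣ x
        d∣x = ∣m+n∣m⇒∣n (subst (d ∣_) (+-comm x v) d∣x+v) d∣v
        d∣k² : d ∣ k ²
        d∣k² = subst (d ∣_) v[x+v]≡k² (∣m⇒∣m*n (x + v) d∣v)

  -- Descent for solutions of opposite parity

  -- x⁴ − x²y² + y⁴ = z², with the negative term moved across since ℕ has no subtraction.
  Quartic : ℕ → ℕ → ℕ → Set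
  Quartic x y z = x ² ² + y ² ² ≡ x ² * y ² + z ²

  Quartic-sym : ∀ {x y z} → Quartic x y z → Quartic y x z
  Quartic-sym {x} {y} {z} q = begin
    y ² ² + x ² ²   ≡⟨ +-comm (y ² ²) (x ² ²) ⟩
    x ² ² + y ² ²   ≡⟨ q ⟩
    x ² * y ² + z ² ≡⟨ cong (_+ z ²) (*-comm (x ²) (y ²)) ⟩
    y ² * x ² + z ² ∎
    where open ≡-Reasoning

  MixedSolution : ℕ → Set
  MixedSolution z = ∃₂ λ x y → Coprime x y × 0 < x × 0 < y × OppositeParity x y × Quartic x y z

  completing-the-square : ∀ m s t d → m ² + 2 * s * t ≡ s ² + 4 * t ² → t + d ≡ s ⊎ s + d ≡ t →
                          m ² ≡ d ² + 3 * t ²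
  completing-the-square m s t d eq (inj₁ refl) = +-cancelʳ-≡ _ _ _ (trans eq (lemma t d))
    where
    lemma : ∀ t d → (t + d) * (t + d) + 4 * (t * t) ≡ (d * d + 3 * (t * t)) + 2 * (t + d) * t
    lemma = solve-∀
  completing-the-square m s t d eq (inj₂ refl) = +-cancelʳ-≡ _ _ _ (trans eq (lemma s d))
    where
    lemma : ∀ s d → s * s + 4 * ((s + d) * (s + d)) ≡ (d * d + 3 * ((s + d) * (s + d))) + 2 * s * (s + d)
    lemma = solve-∀

  factor-pair : ∀ m s t → m ² + 2 * s * t ≡ s ² + 4 * t ² →
    ∃₂ λ A B → A + B ≡ 2 * m × A * B ≡ 3 * t ² × A + 2 * s ≡ B + 2 * t
  factor-pair m s t eq with ≤-total t s
  ... | inj₁ t≤s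
    with d , refl ← m≤n⇒∃[o]m+o≡n t≤s
    with u , refl , u[u+2d]≡3t² ← difference-of-squares m d (completing-the-square m (t + d) t d eq (inj₁ refl))
    = u , u + 2 * d , sum d u , u[u+2d]≡3t² , relation t d u
    where
    sum : ∀ d u → u + (u + 2 * d) ≡ 2 * (d + u)
    sum = solve-∀
    relation : ∀ t d u → u + 2 * (t + d) ≡ u + 2 * d + 2 * t
    relation = solve-∀
  ... | inj₂ s≤t
    with d , refl ← m≤n⇒∃[o]m+o≡n s≤t
    with u , refl , u[u+2d]≡3t² ← difference-of-squares m d (completing-the-square m s (s + d) d eq (inj₂ refl))
    = u + 2 * d , u , sum d u , trans (*-comm (u + 2 * d) u) u[u+2d]≡3t² , relation s d u
    where
    sum : ∀ d u → (u + 2 * d) + u ≡ 2 * (d + u)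
    sum = solve-∀
    relation : ∀ s d u → u + 2 * d + 2 * s ≡ u + 2 * (s + d)
    relation = solve-∀

  opaque
    quartic⇒factor-pair : ∀ {x y z} → Quartic x y z →
      ∃₂ λ A B → A + B ≡ 4 * z × A * B ≡ 3 * y ² ² × A + 4 * x ² ≡ B + 2 * y ²
    quartic⇒factor-pair {x} {y} {z} q =
      let (A , B , A+B≡4z , AB≡3y⁴ , rel) = factor-pair (2 * z) (2 * x ²) (y ²) completed
      in A , B , trans A+B≡4z (sym (*-assoc 2 2 z)) , AB≡3y⁴ , trans (cong (A +_) (*-assoc 2 2 (x ²))) rel
      where
      open ≡-Reasoning
      lemma₁ : ∀ X Y z → (2 * z) * (2 * z) + 2 * (2 * X) * Y ≡ 4 * (X * Y + z * z)
      lemma₁ = solve-∀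
      lemma₂ : ∀ X Y → 4 * (X * X + Y * Y) ≡ (2 * X) * (2 * X) + 4 * (Y * Y)
      lemma₂ = solve-∀
      completed : (2 * z) ² + 2 * (2 * x ²) * y ² ≡ (2 * x ²) ² + 4 * y ² ²
      completed = begin
        (2 * z) ² + 2 * (2 * x ²) * y ² ≡⟨ lemma₁ (x ²) (y ²) z ⟩
        4 * (x ² * y ² + z ²)           ≡⟨ cong (4 *_) q ⟨
        4 * (x ² ² + y ² ²)             ≡⟨ lemma₂ (x ²) (y ²) ⟩
        (2 * x ²) ² + 4 * y ² ²         ∎

  factor-pair-coprime : ∀ {x y A B} → Coprime x y → Odd y → A * B ≡ 3 * y ² ² → A + 4 * x ² ≡ B + 2 * y ² →
                        Coprime A B
  factor-pair-coprime {x} {y} {A} {B} x⊥y odd-y AB≡3y⁴ rel = *≡3*²⇒coprime AB≡3y⁴ common⊥y²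
    where
    odd-y² = odd-* odd-y odd-y
    odd-A : Odd A
    odd-A = proj₁ (odd-*⇒odd A B (subst Odd (sym AB≡3y⁴) (odd-* (1 , refl) (odd-* odd-y² odd-y²))))
    common⊥y² : ∀ {d} → d ∣ A → d ∣ B → Coprime d (y ²)
    common⊥y² {d} d∣A d∣B = coprime-*ʳ d⊥y d⊥y
      where
      d⊥y : Coprime d y
      d⊥y {e} (e∣d , e∣y) = coprime-*ˡ x⊥y x⊥y (e∣x² , e∣y)
        where
        e∣A = ∣-trans e∣d d∣A
        e⊥2 = ∣odd⇒coprime-2 odd-A e∣A
        e∣A+4x² : e ∣ A + 4 * x ²
        e∣A+4x² = subst (e ∣_) (sym rel) (∣m∣n⇒∣m+n (∣-trans e∣d d∣B) (∣n⇒∣m*n 2 (∣m⇒∣m*n y e∣y)))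
        e∣x² = coprime-divisor (coprime-*ʳ e⊥2 e⊥2) (∣m+n∣m⇒∣n e∣A+4x² e∣A)

  v⁴+4x²≢3u⁴+2u²v² : ∀ {x u v} → Even x → Odd u → Odd v → v ² ² + 4 * x ² ≢ 3 * u ² ² + 2 * (u * v) ²
  v⁴+4x²≢3u⁴+2u²v² {x} {u} {v} (w , refl) odd-u odd-v eq =
    let (i , u²≡) = odd-² odd-u
        (j , v²≡) = odd-² odd-v
    in case residue-cong 8 (2 * j + 8 * (j * j) + 2 * (w * w)) (6 * i + 24 * (i * i) + 2 * i + 2 * j + 16 * (i * j)) (begin
      1 + (2 * j + 8 * (j * j) + 2 * (w * w)) * 8         ≡⟨ lemma₁ j w ⟩
      (1 + j * 8) ² + 4 * (w + w) ²                       ≡⟨ cong (λ V → V ² + 4 * (w + w) ²) v²≡ ⟨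
      v ² ² + 4 * (w + w) ²                               ≡⟨ eq ⟩
      3 * u ² ² + 2 * (u * v) ²                           ≡⟨ cong (λ P → 3 * u ² ² + 2 * P) (*-² u v) ⟩
      3 * u ² ² + 2 * (u ² * v ²)                         ≡⟨ cong₂ (λ U V → 3 * U ² + 2 * (U * V)) u²≡ v²≡ ⟩
      3 * (1 + i * 8) ² + 2 * ((1 + i * 8) * (1 + j * 8)) ≡⟨ lemma₂ i j ⟩
      5 + (6 * i + 24 * (i * i) + 2 * i + 2 * j + 16 * (i * j)) * 8 ∎) of λ ()
    where
    open ≡-Reasoning
    lemma₁ : ∀ j w → 1 + (2 * j + 8 * (j * j) + 2 * (w * w)) * 8 ≡ (1 + j * 8) * (1 + j * 8) + 4 * ((w + w) * (w + w))
    lemma₁ = solve-∀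
    lemma₂ : ∀ i j → 3 * ((1 + i * 8) * (1 + i * 8)) + 2 * ((1 + i * 8) * (1 + j * 8)) ≡
                     5 + (6 * i + 24 * (i * i) + 2 * i + 2 * j + 16 * (i * j)) * 8
    lemma₂ = solve-∀

  quartic-of-pythagorean : ∀ {a} p q d → a + q ² ≡ p ² → (p * q) ² + a ² ≡ d ² → Quartic p q d
  quartic-of-pythagorean {a} p q d a+q²≡p² [pq]²+a²≡d² = begin
    p ² ² + q ² ²                                 ≡⟨ cong (λ P → P ² + q ² ²) a+q²≡p² ⟨
    (a + q ²) ² + q ² ²                           ≡⟨ lemma a (q ²) ⟩
    (a + q ²) * q ² + ((a + q ²) * q ² + a ²)     ≡⟨ cong (λ P → P * q ² + (P * q ² + a ²)) a+q²≡p² ⟩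
    p ² * q ² + (p ² * q ² + a ²)                 ≡⟨ cong (λ P → p ² * q ² + (P + a ²)) (*-² p q) ⟨
    p ² * q ² + ((p * q) ² + a ²)                 ≡⟨ cong (p ² * q ² +_) [pq]²+a²≡d² ⟩
    p ² * q ² + d ²                               ∎
    where
    open ≡-Reasoning
    lemma : ∀ a Q → (a + Q) * (a + Q) + Q * Q ≡ (a + Q) * Q + ((a + Q) * Q + a * a)
    lemma = solve-∀

  mixed-solution : ∀ {a b c d} → Odd a → Coprime a c → 0 < c → a ² + 4 * c ² ≡ b ² → c ² + a ² ≡ d ² →
                   MixedSolution d
  mixed-solution {a} {b} {c} {d} odd-a a⊥c 0<c a²+4c²≡b² c²+a²≡d² =
    let (p , q , a+q²≡p² , c≡pq , p⊥q , parity) = pythagorean-triple {z = b} a²+4c²≡b² a⊥c odd-a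
        0<pq = subst (0 <_) c≡pq 0<c
    in p , q , p⊥q , m*n>0⇒m>0 p q 0<pq , m*n>0⇒n>0 p q 0<pq , parity ,
       quartic-of-pythagorean p q d a+q²≡p² (subst (λ c → c ² + a ² ≡ d ²) c≡pq c²+a²≡d²)

  3A²+X≡B²+2AB⇒X≡F[F+4A] : ∀ A B {X} → 3 * A ² + X ≡ B ² + 2 * (A * B) →
                            ∃[ F ] A + F ≡ B × X ≡ F * (F + 4 * A)
  3A²+X≡B²+2AB⇒X≡F[F+4A] A B {X} eq = F , A+F≡B , +-cancelˡ-≡ (3 * A ²) _ _ (begin
    3 * A ² + X                     ≡⟨ eq ⟩
    B ² + 2 * (A * B)               ≡⟨ cong (λ B → B ² + 2 * (A * B)) A+F≡B ⟨
    (A + F) ² + 2 * (A * (A + F))   ≡⟨ lemma A F ⟩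
    3 * A ² + F * (F + 4 * A)       ∎)
    where
    open ≡-Reasoning
    A≤B : A ≤ B
    A≤B with A ≤? B
    ... | yes A≤B = A≤B
    ... | no A≰B = contradiction (sym eq) (<⇒≢ (<-≤-trans B²+2AB<3A² (m≤m+n (3 * A ²) X)))
      where
      B<A = ≰⇒> A≰B
      B²+2AB<3A² : B ² + 2 * (A * B) < 3 * A ²
      B²+2AB<3A² = subst (B ² + 2 * (A * B) <_) (lemma A)
        (+-mono-<-≤ (²-mono-< B<A) (*-monoʳ-≤ 2 (*-monoʳ-≤ A (<⇒≤ B<A))))
        where
        lemma : ∀ A → A * A + 2 * (A * A) ≡ 3 * (A * A)
        lemma = solve-∀
    F = proj₁ (m≤n⇒∃[o]m+o≡n A≤B)
    A+F≡B = proj₂ (m≤n⇒∃[o]m+o≡n A≤B)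
    lemma : ∀ A F → (A + F) * (A + F) + 2 * (A * (A + F)) ≡ 3 * (A * A) + F * (F + 4 * A)
    lemma = solve-∀

  odd²+F≡odd²⇒F≡4f : ∀ {a b F} → Odd a → Odd b → a ² + F ≡ b ² → ∃[ f ] F ≡ 4 * f
  odd²+F≡odd²⇒F≡4f {a} {b} {F} odd-a odd-b a²+F≡b² =
    let (i , a²≡) = odd-² odd-a
        (j , b²≡) = odd-² odd-b
        8i+F≡8j : i * 8 + F ≡ j * 8
        8i+F≡8j = suc-injective (trans (cong (_+ F) (sym a²≡)) (trans a²+F≡b² b²≡))
    in (j ∸ i) * 2 , (begin
      F                 ≡⟨ m+n∸m≡n (i * 8) F ⟨
      i * 8 + F ∸ i * 8 ≡⟨ cong (_∸ i * 8) 8i+F≡8j ⟩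
      j * 8 ∸ i * 8     ≡⟨ *-distribʳ-∸ 8 j i ⟨
      (j ∸ i) * 8       ≡⟨ *-assoc (j ∸ i) 2 4 ⟨
      (j ∸ i) * 2 * 4   ≡⟨ *-comm ((j ∸ i) * 2) 4 ⟩
      4 * ((j ∸ i) * 2) ∎)
    where open ≡-Reasoning

  coprime-+4* : ∀ {m n f} → Coprime m n → m + 4 * f ≡ n → Coprime f (f + m)
  coprime-+4* {m} {n} {f} m⊥n m+4f≡n {d} (d∣f , d∣f+m) = m⊥n (d∣m , d∣n)
    where
    d∣m = ∣m+n∣m⇒∣n d∣f+m d∣f
    d∣n = subst (d ∣_) m+4f≡n (∣m∣n⇒∣m+n d∣m (∣n⇒∣m*n 4 d∣f))

  3a⁴+4x²≡b⁴+2a²b²⇒squares : ∀ {x a b} → Even x → Odd a → Odd b → Coprime a b →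
    3 * a ² ² + 4 * x ² ≡ b ² ² + 2 * (a * b) ² →
    ∃₂ λ c d → a ² + 4 * c ² ≡ b ² × c ² + a ² ≡ d ² × x ≡ 2 * (c * d) × Coprime a c
  3a⁴+4x²≡b⁴+2a²b²⇒squares {x} {a} {b} (w , refl) odd-a odd-b a⊥b rel =
    let (F , a²+F≡b² , 4x²≡F[F+4a²]) = 3A²+X≡B²+2AB⇒X≡F[F+4A] (a ²) (b ²)
                                          (trans rel (cong (λ P → b ² ² + 2 * P) (*-² a b)))
        (f , F≡4f) = odd²+F≡odd²⇒F≡4f odd-a odd-b a²+F≡b²
        a²+4f≡b² = trans (cong (a ² +_) (sym F≡4f)) a²+F≡b²
        f⊥f+a² = coprime-+4* {f = f} (coprime-² a⊥b) a²+4f≡b²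
        f[f+a²]≡w² : f * (f + a ²) ≡ w ²
        f[f+a²]≡w² = *-cancelˡ-≡ _ _ 16 (begin
          16 * (f * (f + a ²))       ≡⟨ lemma₁ f (a ²) ⟩
          (4 * f) * (4 * f + 4 * a ²) ≡⟨ cong (λ F → F * (F + 4 * a ²)) F≡4f ⟨
          F * (F + 4 * a ²)           ≡⟨ 4x²≡F[F+4a²] ⟨
          4 * (w + w) ²               ≡⟨ lemma₂ w ⟩
          16 * w ²                    ∎)
        (c , d , f≡c² , f+a²≡d² , w≡cd , _) = coprime-*≡²⇒² {c = w} f⊥f+a² f[f+a²]≡w²
        a⊥c : Coprime a c
        a⊥c = λ {e} (e∣a , e∣c) →
          let e∣f = subst (e ∣_) (sym f≡c²) (∣m⇒∣m*n c e∣c)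
          in f⊥f+a² (e∣f , ∣m∣n⇒∣m+n e∣f (∣m⇒∣m*n a e∣a))
    in c , d , subst (λ f → a ² + 4 * f ≡ b ²) f≡c² a²+4f≡b² ,
       subst (λ f → f + a ² ≡ d ²) f≡c² f+a²≡d² ,
       trans (lemma₃ w) (cong (2 *_) w≡cd) , a⊥c
    where
    open ≡-Reasoning
    lemma₁ : ∀ f A → 16 * (f * (f + A)) ≡ (4 * f) * (4 * f + 4 * A)
    lemma₁ = solve-∀
    lemma₂ : ∀ w → 4 * ((w + w) * (w + w)) ≡ 16 * (w * w)
    lemma₂ = solve-∀
    lemma₃ : ∀ w → w + w ≡ 2 * w
    lemma₃ = solve-∀

  descent-bound : ∀ {a b c d z} → Odd a → 0 < c → a ² + 4 * c ² ≡ b ² → c ² + a ² ≡ d ² →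
                  3 * a ² ² + b ² ² ≡ 4 * z → d < z
  descent-bound {a} {b} {c} {d} {z} odd-a 0<c a²+4c²≡b² c²+a²≡d² 3a⁴+b⁴≡4z = <-≤-trans (n<n² 1<d) d²≤z
    where
    open ≤-Reasoning
    1<d : 1 < d
    1<d = ²-cancel-< (begin-strict
      1             <⟨ s≤s (s≤s z≤n) ⟩
      1 * 1 + 1 * 1 ≤⟨ +-mono-≤ (*-mono-≤ 0<c 0<c) (*-mono-≤ (odd⇒>0 odd-a) (odd⇒>0 odd-a)) ⟩
      c ² + a ²     ≡⟨ c²+a²≡d² ⟩
      d ²           ∎)
    d²≤z : d ² ≤ z
    d²≤z = *-cancelˡ-≤ 4 (begin
      4 * d ²           ≡⟨ cong (4 *_) c²+a²≡d² ⟨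
      4 * (c ² + a ²)   ≡⟨ lemma (c ²) (a ²) ⟩
      (a ² + 4 * c ²) + 3 * a ² ≡⟨ cong (_+ 3 * a ²) a²+4c²≡b² ⟩
      b ² + 3 * a ²     ≤⟨ +-mono-≤ (n≤n² (b ²)) (*-monoʳ-≤ 3 (n≤n² (a ²))) ⟩
      b ² ² + 3 * a ² ² ≡⟨ +-comm (b ² ²) (3 * a ² ²) ⟩
      3 * a ² ² + b ² ² ≡⟨ 3a⁴+b⁴≡4z ⟩
      4 * z             ∎)
      where
      lemma : ∀ C A → 4 * (C + A) ≡ (A + 4 * C) + 3 * A
      lemma = solve-∀

  prime-3 : Prime 3
  prime-3 = from-yes (prime? 3)

  descent-3∣A : ∀ {x z a b} → Even x → 0 < x → Odd a → Odd b → Coprime a b →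
    3 * a ² ² + 4 * x ² ≡ b ² ² + 2 * (a * b) ² → 3 * a ² ² + b ² ² ≡ 4 * z → ∃[ d ] d < z × MixedSolution d
  descent-3∣A {x} {z} {a} {b} even-x 0<x odd-a odd-b a⊥b rel 3a⁴+b⁴≡4z
    with c , d , a²+4c²≡b² , c²+a²≡d² , refl , a⊥c
           ← 3a⁴+4x²≡b⁴+2a²b²⇒squares even-x odd-a odd-b a⊥b rel =
    d , descent-bound {b = b} odd-a 0<c a²+4c²≡b² c²+a²≡d² 3a⁴+b⁴≡4z ,
    mixed-solution {b = b} {d = d} odd-a a⊥c 0<c a²+4c²≡b² c²+a²≡d²
    where
    0<c = m*n>0⇒m>0 c d (m*n>0⇒n>0 2 (c * d) 0<x)

  factor-pair-descent : ∀ {x y z A B} → Even x → 0 < x → Odd y → Coprime A B →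
    A + B ≡ 4 * z → A * B ≡ 3 * y ² ² → A + 4 * x ² ≡ B + 2 * y ² → 3 ∣ A ⊎ 3 ∣ B →
    ∃[ d ] d < z × MixedSolution d
  factor-pair-descent {y = y} even-x 0<x odd-y A⊥B A+B≡4z AB≡3y⁴ rel (inj₁ 3∣A)
    with a , b , refl , refl , refl , a⊥b ← coprime-*≡3*⁴⇒3*⁴×⁴ {y = y} A⊥B AB≡3y⁴ 3∣A =
    let (odd-a , odd-b) = odd-*⇒odd a b odd-y
    in descent-3∣A even-x 0<x odd-a odd-b a⊥b rel A+B≡4z
  factor-pair-descent {y = y} {A = A} {B} even-x 0<x odd-y A⊥B A+B≡4z AB≡3y⁴ rel (inj₂ 3∣B)
    with u , v , refl , refl , refl , _
           ← coprime-*≡3*⁴⇒3*⁴×⁴ {y = y} (Coprime.sym A⊥B) (trans (*-comm B A) AB≡3y⁴) 3∣B =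
    let (odd-u , odd-v) = odd-*⇒odd u v odd-y
    in ⊥-elim (v⁴+4x²≢3u⁴+2u²v² even-x odd-u odd-v rel)

  descent-step : ∀ {x y z} → Coprime x y → 0 < x → Even x → Odd y → Quartic x y z →
                 ∃[ d ] d < z × MixedSolution d
  descent-step {x} {y} {z} x⊥y 0<x even-x odd-y q
    with A , B , A+B≡4z , AB≡3y⁴ , rel ← quartic⇒factor-pair {x} {y} {z} q =
    factor-pair-descent even-x 0<x odd-y (factor-pair-coprime x⊥y odd-y AB≡3y⁴ rel) A+B≡4z AB≡3y⁴ rel
      (euclidsLemma A B prime-3 (divides (y ² ²) (trans AB≡3y⁴ (*-comm 3 (y ² ²)))))

  no-mixed-solution : ∀ z → ¬ MixedSolution z
  no-mixed-solution = <-rec (λ z → ¬ MixedSolution z) λ z no-smaller sol →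
    let (d , d<z , smaller) = descend sol in no-smaller d<z smaller
    where
    descend : ∀ {z} → MixedSolution z → ∃[ d ] d < z × MixedSolution d
    descend (x , y , x⊥y , 0<x , _   , inj₁ (even-x , odd-y) , q) = descent-step x⊥y 0<x even-x odd-y q
    descend {z} (x , y , x⊥y , _   , 0<y , inj₂ (odd-x , even-y) , q) =
      descent-step (Coprime.sym x⊥y) 0<y even-y odd-x (Quartic-sym {x} {y} {z} q)

  -- Solutions with x and y odd

  ¬[a²+c²,a²+4c²]-squares : ∀ {a c b d} → 0 < a → 0 < c → Coprime a c →
                            a ² + c ² ≡ d ² → a ² + 4 * c ² ≡ b ² → ⊥
  ¬[a²+c²,a²+4c²]-squares {a} {c} {b} {d} 0<a 0<c a⊥c a²+c²≡d² a²+4c²≡b² with even-or-odd a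
  ... | inj₂ odd-a = no-mixed-solution d
    (mixed-solution {b = b} {d = d} odd-a a⊥c 0<c a²+4c²≡b² (trans (+-comm (c ²) (a ²)) a²+c²≡d²))
  ... | inj₁ (k , refl)
    with e , refl ← even-²⁻¹ {b}
      (subst Even a²+4c²≡b² (even+even⇒even (even-*ʳ (k + k) (k , refl)) (even-*ʳ (c ²) (2 , refl))))
    = no-mixed-solution e (mixed-solution {b = d} {d = e} odd-c c⊥k 0<k c²+4k²≡d² k²+c²≡e²)
    where
    open ≡-Reasoning
    k+k≡2k : ∀ k → k + k ≡ 2 * k
    k+k≡2k = solve-∀
    [k+k]²≡4k² : ∀ k → (k + k) * (k + k) ≡ 4 * (k * k)
    [k+k]²≡4k² = solve-∀
    4[k²+c²]≡[k+k]²+4c² : ∀ k c → 4 * (k * k + c * c) ≡ (k + k) * (k + k) + 4 * (c * c)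
    4[k²+c²]≡[k+k]²+4c² = solve-∀
    odd-c : Odd c
    odd-c = ¬even⇒odd (coprime⇒¬even∧even a⊥c (k , refl))
    c⊥k : Coprime c k
    c⊥k = Coprime.sym (coprime-∣ˡ a⊥c (divides 2 (k+k≡2k k)))
    0<k : 0 < k
    0<k = m*n>0⇒n>0 2 k (subst (0 <_) (k+k≡2k k) 0<a)
    c²+4k²≡d² : c ² + 4 * k ² ≡ d ²
    c²+4k²≡d² = trans (cong (c ² +_) (sym ([k+k]²≡4k² k))) (trans (+-comm (c ²) _) a²+c²≡d²)
    k²+c²≡e² : k ² + c ² ≡ e ²
    k²+c²≡e² = *-cancelˡ-≡ _ _ 4 (begin
      4 * (k ² + c ²)     ≡⟨ 4[k²+c²]≡[k+k]²+4c² k c ⟩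
      (k + k) ² + 4 * c ² ≡⟨ a²+4c²≡b² ⟩
      (e + e) ²           ≡⟨ [k+k]²≡4k² e ⟩
      4 * e ²             ∎)

  ¬[e²+2g²,g²+2e²]-squares : ∀ {e g h f} → Coprime e h → e ² + 2 * g ² ≡ h ² → g ² + 2 * e ² ≡ f ² → ⊥
  ¬[e²+2g²,g²+2e²]-squares {e} {g} {h} {f} e⊥h e²+2g²≡h² g²+2e²≡f²
    with even-or-odd e | even-or-odd h
  ... | inj₁ even-e | inj₁ even-h = coprime⇒¬even∧even e⊥h even-e even-h
  ... | inj₁ even-e | inj₂ odd-h  = even⇒¬odd
    (subst Even e²+2g²≡h² (even+even⇒even (even-*ʳ e even-e) (even-*ʳ (g ²) (1 , refl)))) (odd-* odd-h odd-h)
  ... | inj₂ odd-e  | inj₁ even-h = even⇒¬odd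
    (even-*ʳ h even-h) (subst Odd e²+2g²≡h² (odd+even⇒odd (odd-* odd-e odd-e) (even-*ʳ (g ²) (1 , refl))))
  ... | inj₂ odd-e  | inj₂ odd-h  with odd-² odd-e | even-or-odd g
  ...   | b , e²≡ | inj₂ odd-g =
    let (c , g²≡) = odd-² odd-g
        (l , h²≡) = odd-² odd-h
    in case residue-cong 8 (b + 2 * c) l (begin
      3 + (b + 2 * c) * 8         ≡⟨ lemma b c ⟩
      (1 + b * 8) + 2 * (1 + c * 8) ≡⟨ cong₂ (λ E G → E + 2 * G) e²≡ g²≡ ⟨
      e ² + 2 * g ²               ≡⟨ e²+2g²≡h² ⟩
      h ²                         ≡⟨ h²≡ ⟩
      1 + l * 8                   ∎) of λ ()
    where
    open ≡-Reasoning
    lemma : ∀ b c → 3 + (b + 2 * c) * 8 ≡ (1 + b * 8) + 2 * (1 + c * 8)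
    lemma = solve-∀
  ...   | b , e²≡ | inj₁ even-g =
    let (c , g²≡) = even-² even-g
    in 2+4k≢² (c + 4 * b) f (begin
      2 + (c + 4 * b) * 4       ≡⟨ lemma b c ⟩
      c * 4 + 2 * (1 + b * 8)   ≡⟨ cong₂ (λ G E → G + 2 * E) g²≡ e²≡ ⟨
      g ² + 2 * e ²             ≡⟨ g²+2e²≡f² ⟩
      f ²                       ∎)
    where
    open ≡-Reasoning
    lemma : ∀ b c → 2 + (c + 4 * b) * 4 ≡ c * 4 + 2 * (1 + b * 8)
    lemma = solve-∀

  opaque
    f²h²≡3e²g²+e²f²+g²h²⇒e²+kg²≡h² : ∀ {e f g h} → 0 < f → Coprime f g →
      f ² * h ² ≡ 3 * (e ² * g ²) + e ² * f ² + g ² * h ² →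
      ∃[ k ] e ² + k * g ² ≡ h ² × k * g ² + 4 * e ² ≡ k * f ²
    f²h²≡3e²g²+e²f²+g²h²⇒e²+kg²≡h² {e} {f} {g} {h} 0<f f⊥g eq =
      let (K , e²+K≡h²) = m≤n⇒∃[o]m+o≡n e²≤h²
          f²K≡g²[K+4e²] : f ² * K ≡ g ² * (K + 4 * e ²)
          f²K≡g²[K+4e²] = +-cancelˡ-≡ (e ² * f ²) _ _ (begin
            e ² * f ² + f ² * K                           ≡⟨ lemma₁ (e ²) (f ²) K ⟩
            f ² * (e ² + K)                               ≡⟨ cong (f ² *_) e²+K≡h² ⟩
            f ² * h ²                                     ≡⟨ eq ⟩
            3 * (e ² * g ²) + e ² * f ² + g ² * h ²       ≡⟨ cong (λ H → 3 * (e ² * g ²) + e ² * f ² + g ² * H) e²+K≡h² ⟨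
            3 * (e ² * g ²) + e ² * f ² + g ² * (e ² + K) ≡⟨ lemma₂ (e ²) (f ²) (g ²) K ⟩
            e ² * f ² + g ² * (K + 4 * e ²)               ∎)
          (divides k K+4e²≡kf²) =
            coprime-divisor (coprime-² f⊥g) (divides K (trans (sym f²K≡g²[K+4e²]) (*-comm (f ²) K)))
          K≡kg² : K ≡ k * g ²
          K≡kg² = *-cancelˡ-≡ _ _ (f ²) (begin
            f ² * K              ≡⟨ f²K≡g²[K+4e²] ⟩
            g ² * (K + 4 * e ²)  ≡⟨ cong (g ² *_) K+4e²≡kf² ⟩
            g ² * (k * f ²)      ≡⟨ lemma₃ (f ²) (g ²) k ⟩
            f ² * (k * g ²)      ∎)
      in k , subst (λ K → e ² + K ≡ h ²) K≡kg² e²+K≡h² ,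
         subst (λ K → K + 4 * e ² ≡ k * f ²) K≡kg² K+4e²≡kf²
      where
      open ≡-Reasoning
      instance
        f²≢0 : NonZero (f ²)
        f²≢0 = >-nonZero (*-mono-≤ 0<f 0<f)
      lemma₁ : ∀ E F K → E * F + F * K ≡ F * (E + K)
      lemma₁ = solve-∀
      lemma₂ : ∀ E F G K → 3 * (E * G) + E * F + G * (E + K) ≡ E * F + G * (K + 4 * E)
      lemma₂ = solve-∀
      lemma₃ : ∀ F G k → G * (k * F) ≡ F * (k * G)
      lemma₃ = solve-∀
      e²≤h² : e ² ≤ h ²
      e²≤h² with e ² ≤? h ²
      ... | yes e²≤h² = e²≤h²
      ... | no e²≰h² = contradiction eq (<⇒≢ (<-≤-trans (*-monoʳ-< (f ²) (≰⇒> e²≰h²))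
        (subst (_≤ 3 * (e ² * g ²) + e ² * f ² + g ² * h ²) (*-comm (e ²) (f ²))
          (≤-trans (m≤n+m (e ² * f ²) (3 * (e ² * g ²))) (m≤m+n _ (g ² * h ²))))))

  ¬f²h²≡3e²g²+e²f²+g²h² : ∀ {e f g h} → 0 < e → 0 < f → 0 < g → Coprime e h → Coprime f g → Coprime e g →
    f ² * h ² ≢ 3 * (e ² * g ²) + e ² * f ² + g ² * h ²
  ¬f²h²≡3e²g²+e²f²+g²h² {e} {f} {g} {h} 0<e 0<f 0<g e⊥h f⊥g e⊥g eq =
    let (k , e²+kg²≡h² , kg²+4e²≡kf²) = f²h²≡3e²g²+e²f²+g²h²⇒e²+kg²≡h² {e} {f} {g} {h} 0<f f⊥g eq
        k∣4e² = ∣m+n∣m⇒∣n (subst (k ∣_) (sym kg²+4e²≡kf²) (m∣m*n (f ²))) (m∣m*n (g ²))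
        k∣4h² = subst (k ∣_) (4h²≡kf²+3kg² {k} e²+kg²≡h² kg²+4e²≡kf²)
                  (∣m∣n⇒∣m+n (m∣m*n (f ²)) (∣n⇒∣m*n 3 (m∣m*n (g ²))))
    in by-cases (∣4⇒≡1∨≡2∨≡4 (∣4*²∧∣4*²⇒∣4 k∣4e² k∣4h² e⊥h)) e²+kg²≡h² kg²+4e²≡kf²
    where
    4h²≡kf²+3kg² : ∀ {k} → e ² + k * g ² ≡ h ² → k * g ² + 4 * e ² ≡ k * f ² →
                   k * f ² + 3 * (k * g ²) ≡ 4 * h ²
    4h²≡kf²+3kg² {k} e²+kg²≡h² kg²+4e²≡kf² =
      trans (cong (_+ 3 * (k * g ²)) (sym kg²+4e²≡kf²)) (trans (lemma (e ²) (g ²) k) (cong (4 *_) e²+kg²≡h²))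
      where
      lemma : ∀ E G k → (k * G + 4 * E) + 3 * (k * G) ≡ 4 * (E + k * G)
      lemma = solve-∀
    by-cases : ∀ {k} → k ≡ 1 ⊎ k ≡ 2 ⊎ k ≡ 4 → e ² + k * g ² ≡ h ² → k * g ² + 4 * e ² ≡ k * f ² → ⊥
    by-cases (inj₁ refl) e²+g²≡h² g²+4e²≡f² = ¬[a²+c²,a²+4c²]-squares {g} {e} {f} {h} 0<g 0<e (Coprime.sym e⊥g)
      (trans (+-comm (g ²) (e ²)) (trans (cong (e ² +_) (sym (*-identityˡ (g ²)))) e²+g²≡h²))
      (trans (cong (_+ 4 * e ²) (sym (*-identityˡ (g ²)))) (trans g²+4e²≡f² (*-identityˡ (f ²))))
    by-cases (inj₂ (inj₁ refl)) e²+2g²≡h² 2g²+4e²≡2f² = ¬[e²+2g²,g²+2e²]-squares {e} {g} {h} {f} e⊥h e²+2g²≡h²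
      (*-cancelˡ-≡ _ _ 2 (trans (lemma (g ²) (e ²)) 2g²+4e²≡2f²))
      where
      lemma : ∀ G E → 2 * (G + 2 * E) ≡ 2 * G + 4 * E
      lemma = solve-∀
    by-cases (inj₂ (inj₂ refl)) e²+4g²≡h² 4g²+4e²≡4f² = ¬[a²+c²,a²+4c²]-squares {e} {g} {h} {f} 0<e 0<g e⊥g
      (*-cancelˡ-≡ _ _ 4 (trans (lemma (e ²) (g ²)) 4g²+4e²≡4f²)) e²+4g²≡h²
      where
      lemma : ∀ E G → 4 * (E + G) ≡ 4 * G + 4 * E
      lemma = solve-∀

  ¬β²≡3α²+s²+t² : ∀ {s t α β} → Coprime s t → Coprime α β → 0 < α → 0 < s → s * t ≡ α * β →
                  β ² ≢ 3 * α ² + (s ² + t ²)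
  ¬β²≡3α²+s²+t² {s} {t} {α} {β} s⊥t α⊥β 0<α 0<s st≡αβ eq =
    let (e , f , g , h , α≡eg , s≡ef , β≡fh , t≡gh) = four-number-lemma (sym st≡αβ) 0<α 0<s
        0<eg = subst (0 <_) α≡eg 0<α
        0<ef = subst (0 <_) s≡ef 0<s
        e∣α = divides g (trans α≡eg (*-comm e g))
        h∣β = divides f β≡fh
        e∣s = divides f (trans s≡ef (*-comm e f))
        f∣s = divides e s≡ef
        g∣t = divides h (trans t≡gh (*-comm g h))
    in ¬f²h²≡3e²g²+e²f²+g²h² {e} {f} {g} {h} (m*n>0⇒m>0 e g 0<eg) (m*n>0⇒n>0 e f 0<ef) (m*n>0⇒n>0 e g 0<eg)
         (coprime-∣ˡ (coprime-∣ʳ α⊥β h∣β) e∣α) (coprime-∣ˡ (coprime-∣ʳ s⊥t g∣t) f∣s)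
         (coprime-∣ˡ (coprime-∣ʳ s⊥t g∣t) e∣s) (begin
           f ² * h ²                                     ≡⟨ *-² f h ⟨
           (f * h) ²                                     ≡⟨ cong _² β≡fh ⟨
           β ²                                           ≡⟨ eq ⟩
           3 * α ² + (s ² + t ²)                         ≡⟨ cong₂ (λ α s → 3 * α ² + (s ² + t ²)) α≡eg s≡ef ⟩
           3 * (e * g) ² + ((e * f) ² + t ²)             ≡⟨ cong (λ t → 3 * (e * g) ² + ((e * f) ² + t ²)) t≡gh ⟩
           3 * (e * g) ² + ((e * f) ² + (g * h) ²)       ≡⟨ lemma e f g h ⟩
           3 * (e ² * g ²) + e ² * f ² + g ² * h ²       ∎)
    where
    open ≡-Reasoning
    lemma : ∀ e f g h → 3 * ((e * g) * (e * g)) + ((e * f) * (e * f) + (g * h) * (g * h)) ≡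
                        3 * ((e * e) * (g * g)) + (e * e) * (f * f) + (g * g) * (h * h)
    lemma = solve-∀

  ¬3β²≡α²+s²+t² : ∀ {s t α β} → OppositeParity s t → Coprime β α → s * t ≡ β * α →
                  3 * β ² ≢ α ² + (s ² + t ²)
  ¬3β²≡α²+s²+t² {s} {t} {α} {β} parity β⊥α st≡βα eq with opposite-parity⇒²+²≡1+4r parity
  ... | r , s²+t²≡ with even-or-odd β | even-or-odd α
  ... | inj₁ even-β | inj₁ even-α = coprime⇒¬even∧even β⊥α even-β even-α
  ... | inj₂ odd-β  | inj₂ odd-α  =
    even⇒¬odd (subst Even st≡βα (opposite-parity⇒even-* parity)) (odd-* odd-β odd-α)
  ... | inj₁ even-β | inj₂ odd-α  =
    let (m , β²≡) = even-² even-β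
        (a , α²≡) = odd-² odd-α
    in case residue-cong 4 (3 * m) (2 * a + r) (begin
      0 + 3 * m * 4               ≡⟨ lemma₁ m ⟩
      3 * (m * 4)                 ≡⟨ cong (3 *_) β²≡ ⟨
      3 * β ²                     ≡⟨ eq ⟩
      α ² + (s ² + t ²)           ≡⟨ cong₂ _+_ α²≡ s²+t²≡ ⟩
      (1 + a * 8) + (1 + r * 4)   ≡⟨ lemma₂ a r ⟩
      2 + (2 * a + r) * 4         ∎) of λ ()
    where
    open ≡-Reasoning
    lemma₁ : ∀ m → 0 + 3 * m * 4 ≡ 3 * (m * 4)
    lemma₁ = solve-∀
    lemma₂ : ∀ a r → (1 + a * 8) + (1 + r * 4) ≡ 2 + (2 * a + r) * 4
    lemma₂ = solve-∀
  ... | inj₂ odd-β  | inj₁ even-α =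
    let (b , β²≡) = odd-² odd-β
        (m , α²≡) = even-² even-α
    in case residue-cong 4 (6 * b) (m + r) (begin
      3 + 6 * b * 4               ≡⟨ lemma₁ b ⟩
      3 * (1 + b * 8)             ≡⟨ cong (3 *_) β²≡ ⟨
      3 * β ²                     ≡⟨ eq ⟩
      α ² + (s ² + t ²)           ≡⟨ cong₂ _+_ α²≡ s²+t²≡ ⟩
      m * 4 + (1 + r * 4)         ≡⟨ lemma₂ m r ⟩
      1 + (m + r) * 4             ∎) of λ ()
    where
    open ≡-Reasoning
    lemma₁ : ∀ b → 3 + 6 * b * 4 ≡ 3 * (1 + b * 8)
    lemma₁ = solve-∀
    lemma₂ : ∀ m r → m * 4 + (1 + r * 4) ≡ 1 + (m + r) * 4
    lemma₂ = solve-∀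

  ¬P[P+D]≡3[st]² : ∀ {s t P} → Coprime s t → OppositeParity s t → 0 < s → 0 < t →
                    P * (P + (s ² + t ²)) ≢ 3 * (s * t) ²
  ¬P[P+D]≡3[st]² {s} {t} {P} s⊥t parity 0<s 0<t eq =
    by-cases (euclidsLemma P (P + D) prime-3 (divides ((s * t) ²) (trans eq (*-comm 3 ((s * t) ²)))))
    where
    D = s ² + t ²
    P⊥P+D : Coprime P (P + D)
    P⊥P+D = *≡3*²⇒coprime eq λ {d} d∣P d∣P+D →
      let d∣D = ∣m+n∣m⇒∣n d∣P+D d∣P
      in coprime-*ʳ (∣²+²⇒coprime s⊥t d∣D)
                    (∣²+²⇒coprime (Coprime.sym s⊥t) (subst (d ∣_) (+-comm (s ²) (t ²)) d∣D))
    0<P : 0 < P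
    0<P = n≢0⇒n>0 λ P≡0 → <⇒≢ 0<3[st]² (sym (trans (sym eq) (cong (λ P → P * (P + D)) P≡0)))
      where
      0<3[st]² : 0 < 3 * (s * t) ²
      0<3[st]² = ≤-trans (s≤s z≤n) (*-monoʳ-≤ 3 (*-mono-≤ (*-mono-≤ 0<s 0<t) (*-mono-≤ 0<s 0<t)))
    by-cases : 3 ∣ P ⊎ 3 ∣ P + D → ⊥
    by-cases (inj₁ 3∣P) =
      let (α , β , P≡3α² , P+D≡β² , st≡αβ , α⊥β) = coprime-*≡3*²⇒3*²×² {c = s * t} P⊥P+D eq 3∣P
          0<α = m*n>0⇒m>0 α α (m*n>0⇒n>0 3 (α ²) (subst (0 <_) P≡3α² 0<P))
      in ¬β²≡3α²+s²+t² s⊥t α⊥β 0<α 0<s st≡αβ (trans (sym P+D≡β²) (cong (_+ D) P≡3α²))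
    by-cases (inj₂ 3∣P+D) =
      let (β , α , P+D≡3β² , P≡α² , st≡βα , β⊥α) =
            coprime-*≡3*²⇒3*²×² {c = s * t} (Coprime.sym P⊥P+D) (trans (*-comm (P + D) P) eq) 3∣P+D
      in ¬3β²≡α²+s²+t² parity β⊥α st≡βα (trans (sym P+D≡3β²) (cong (_+ D) P≡α²))

  ¬z²≡[s²+t²]²+12s²t² : ∀ {s t z} → Coprime s t → OppositeParity s t → 0 < s → 0 < t →
                         z ² ≢ (s ² + t ²) ² + 12 * (s ² * t ²)
  ¬z²≡[s²+t²]²+12s²t² {s} {t} {z} s⊥t parity 0<s 0<t eq
    with u , _ , u[u+2D]≡12s²t² ← difference-of-squares z (s ² + t ²) eq
    with even-or-odd u
  ... | inj₂ odd-u = even⇒¬odd (subst Even (sym u[u+2D]≡12s²t²) (even-*ʳ (s ² * t ²) (6 , refl)))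
                       (odd-* odd-u (odd+even⇒odd odd-u (even-*ʳ (s ² + t ²) (1 , refl))))
  ... | inj₁ (P , refl) = ¬P[P+D]≡3[st]² {P = P} s⊥t parity 0<s 0<t (*-cancelˡ-≡ _ _ 4 (begin
    4 * (P * (P + D))               ≡⟨ lemma₁ P D ⟩
    (P + P) * ((P + P) + 2 * D)     ≡⟨ u[u+2D]≡12s²t² ⟩
    12 * (s ² * t ²)                ≡⟨ lemma₂ s t ⟩
    4 * (3 * (s * t) ²)             ∎))
    where
    open ≡-Reasoning
    D = s ² + t ²
    lemma₁ : ∀ P D → 4 * (P * (P + D)) ≡ (P + P) * ((P + P) + 2 * D)
    lemma₁ = solve-∀
    lemma₂ : ∀ s t → 12 * ((s * s) * (t * t)) ≡ 4 * (3 * ((s * t) * (s * t)))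
    lemma₂ = solve-∀

  odd-quartic-trivial : ∀ {x y z} → Coprime x y → Odd x → Odd y → y < x → ¬ Quartic x y z
  odd-quartic-trivial {x} {y} {z} x⊥y odd-x odd-y y<x q
    with G , y+G≡x ← m≤n⇒∃[o]m+o≡n (<⇒≤ y<x)
    with even-or-odd G
  ... | inj₂ odd-G = even⇒¬odd (subst Even y+G≡x (odd+odd⇒even odd-y odd-G)) odd-x
  ... | inj₁ (t , refl) =
    ¬z²≡[s²+t²]²+12s²t² {z = z} s⊥t (odd-+⇒opposite-parity (subst Odd (sym s+t≡x) odd-x)) 0<s 0<t
      (+-cancelˡ-≡ (x ² * y ²) _ _ (begin
        x ² * y ² + z ²                                           ≡⟨ q ⟨
        x ² ² + y ² ²                                             ≡⟨ cong (λ x → x ² ² + y ² ²) y+G≡x ⟨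
        (y + (t + t)) ² ² + y ² ²                                 ≡⟨ lemma y t ⟩
        (y + (t + t)) ² * y ² + ((s ² + t ²) ² + 12 * (s ² * t ²)) ≡⟨ cong (λ x → x ² * y ² + ((s ² + t ²) ² + 12 * (s ² * t ²))) y+G≡x ⟩
        x ² * y ² + ((s ² + t ²) ² + 12 * (s ² * t ²))            ∎))
    where
    s = y + t
    s+t≡x : s + t ≡ x
    s+t≡x = trans (+-assoc y t t) y+G≡x
    s⊥t : Coprime s t
    s⊥t {d} (d∣s , d∣t) =
      x⊥y (subst (d ∣_) s+t≡x (∣m∣n⇒∣m+n d∣s d∣t) , ∣m+n∣m⇒∣n (subst (d ∣_) (+-comm y t) d∣s) d∣t)
    0<s : 0 < s
    0<s = ≤-trans (odd⇒>0 odd-y) (m≤m+n y t)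
    0<t : 0 < t
    0<t = n≢0⇒n>0 λ t≡0 →
      <⇒≢ y<x (trans (sym (+-identityʳ y)) (trans (cong (λ t → y + (t + t)) (sym t≡0)) y+G≡x))
    open ≡-Reasoning
    lemma : ∀ y t →
      ((y + (t + t)) * (y + (t + t))) * ((y + (t + t)) * (y + (t + t))) + (y * y) * (y * y) ≡
      ((y + (t + t)) * (y + (t + t))) * (y * y) +
      (((y + t) * (y + t) + t * t) * ((y + t) * (y + t) + t * t) + 12 * (((y + t) * (y + t)) * (t * t)))
    lemma = solve-∀

  quartic-trivial : ∀ {x y z} → Coprime x y → 0 < y → Quartic x y z → x ≡ 0 ⊎ x ≡ y
  quartic-trivial {zero} _ _ _ = inj₁ refl
  quartic-trivial {x@(suc _)} {y} {z} x⊥y 0<y q with even-or-odd x | even-or-odd y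
  ... | inj₁ even-x | inj₁ even-y = ⊥-elim (coprime⇒¬even∧even x⊥y even-x even-y)
  ... | inj₁ even-x | inj₂ odd-y  =
    ⊥-elim (no-mixed-solution z (x , y , x⊥y , s≤s z≤n , 0<y , inj₁ (even-x , odd-y) , q))
  ... | inj₂ odd-x  | inj₁ even-y =
    ⊥-elim (no-mixed-solution z (x , y , x⊥y , s≤s z≤n , 0<y , inj₂ (odd-x , even-y) , q))
  ... | inj₂ odd-x  | inj₂ odd-y  with <-cmp x y
  ...   | tri< x<y _ _ = ⊥-elim (odd-quartic-trivial {z = z} (Coprime.sym x⊥y) odd-y odd-x x<y (Quartic-sym {x} {y} {z} q))
  ...   | tri≈ _ x≡y _ = inj₂ x≡y
  ...   | tri> _ _ y<x = ⊥-elim (odd-quartic-trivial {z = z} x⊥y odd-x odd-y y<x q)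

-- Rational points

open QuarticEquation using (_²; coprime-²; Quartic; quartic-trivial)
open import Data.Nat as ℕ using (zero; suc; s≤s; z≤n)
import Data.Nat.Properties as ℕ
open import Data.Nat.Divisibility using (_∣_; divides; ∣1⇒≡1; ∣-refl)
open import Data.Integer as ℤ using (ℤ; +_; -[1+_]; ∣_∣)
import Data.Integer.Properties as ℤ
import Data.Integer.Tactic.RingSolver as ℤ-Solver
open import Data.Rational using (ℚ; mkℚ; toℚᵘ; 0ℚ; 1ℚ; _+_; _-_; _*_; -_)
import Data.Rational.Properties as ℚ
open import Data.Rational.Solver using (module +-*-Solver)
open import Data.Rational.Unnormalised using (*≡*)
import Data.Rational.Unnormalised.Properties as ℚᵘ

fromℤ : ℤ → ℚ
fromℤ i = mkℚ i 0 (Coprime.sym (1-coprimeTo ∣ i ∣))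

fromℤ-* : ∀ i j → fromℤ (i ℤ.* j) ≡ fromℤ i * fromℤ j
fromℤ-* i j = ℚ.toℚᵘ-injective (ℚᵘ.≃-sym (ℚ.toℚᵘ-homo-* (fromℤ i) (fromℤ j)))

fromℤ-+ : ∀ i j → fromℤ (i ℤ.+ j) ≡ fromℤ i + fromℤ j
fromℤ-+ i j =
  ℚ.toℚᵘ-injective (ℚᵘ.≃-trans (*≡* (lemma i j)) (ℚᵘ.≃-sym (ℚ.toℚᵘ-homo-+ (fromℤ i) (fromℤ j))))
  where
  lemma : ∀ i j → (i ℤ.+ j) ℤ.* + 1 ≡ (i ℤ.* + 1 ℤ.+ j ℤ.* + 1) ℤ.* + 1
  lemma = ℤ-Solver.solve-∀

fromℤ-neg : ∀ i → fromℤ (ℤ.- i) ≡ - fromℤ i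
fromℤ-neg i = ℚ.toℚᵘ-injective (ℚᵘ.≃-sym (ℚ.toℚᵘ-homo‿- (fromℤ i)))

i*i≡+∣i∣² : ∀ i → i ℤ.* i ≡ + (∣ i ∣ ²)
i*i≡+∣i∣² (+ zero)  = refl
i*i≡+∣i∣² (+ suc n) = refl
i*i≡+∣i∣² -[1+ n ]  = refl

square≡fromℤ⇒square : ∀ (q : ℚ) (M : ℤ) → q * q ≡ fromℤ M → ∃[ A ] M ≡ + (A ²)
square≡fromℤ⇒square q@(mkℚ a k a⊥k) M q²≡M = ∣ a ∣ , (begin
  M                     ≡⟨ ℤ.*-identityʳ M ⟨
  M ℤ.* + 1             ≡⟨ cong (λ n → M ℤ.* + n) K²≡1 ⟨
  M ℤ.* + (K ²)         ≡⟨ a²≡MK² ⟨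
  a ℤ.* a ℤ.* + 1       ≡⟨ ℤ.*-identityʳ (a ℤ.* a) ⟩
  a ℤ.* a               ≡⟨ i*i≡+∣i∣² a ⟩
  + (∣ a ∣ ²)           ∎)
  where
  open ≡-Reasoning
  K = suc k
  a²≡MK² : a ℤ.* a ℤ.* + 1 ≡ M ℤ.* + (K ²)
  a²≡MK² with *≡* eq ← ℚᵘ.≃-trans (ℚᵘ.≃-sym (ℚ.toℚᵘ-homo-* q q)) (ℚᵘ.≃-reflexive (cong toℚᵘ q²≡M))
    = eq
  K²∣∣a∣² : K ² ∣ ∣ a ∣ ² ℕ.* 1
  K²∣∣a∣² = divides ∣ M ∣ (begin
    ∣ a ∣ ² ℕ.* 1              ≡⟨ cong (ℕ._* 1) (ℤ.abs-* a a) ⟨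
    ∣ a ℤ.* a ∣ ℕ.* 1          ≡⟨ ℤ.abs-* (a ℤ.* a) (+ 1) ⟨
    ∣ a ℤ.* a ℤ.* + 1 ∣        ≡⟨ cong ∣_∣ a²≡MK² ⟩
    ∣ M ℤ.* + (K ²) ∣          ≡⟨ ℤ.abs-* M (+ (K ²)) ⟩
    ∣ M ∣ ℕ.* K ²              ∎)
  K²≡1 : K ² ≡ 1
  K²≡1 = ∣1⇒≡1 (coprime-divisor (coprime-² (Coprime.sym (recompute a⊥k))) K²∣∣a∣²)

ℤ-quartic⇒Quartic : ∀ n d A →
  + (A ²) ≡ n ℤ.* n ℤ.* (n ℤ.* n) ℤ.- n ℤ.* n ℤ.* (+ d ℤ.* + d) ℤ.+ + d ℤ.* + d ℤ.* (+ d ℤ.* + d) →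
  Quartic ∣ n ∣ d A
ℤ-quartic⇒Quartic n d A eq = ℤ.+-injective (begin
  + (N ℕ.* N ℕ.+ D ℕ.* D)          ≡⟨ ℤ.pos-+ (N ℕ.* N) (D ℕ.* D) ⟩
  + (N ℕ.* N) ℤ.+ + (D ℕ.* D)      ≡⟨ cong₂ ℤ._+_ (ℤ.pos-* N N) (ℤ.pos-* D D) ⟩
  + N ℤ.* + N ℤ.+ + D ℤ.* + D      ≡⟨ lemma (+ (A ²)) (+ N) (+ D) eq′ ⟩
  + N ℤ.* + D ℤ.+ + (A ²)          ≡⟨ cong (ℤ._+ + (A ²)) (ℤ.pos-* N D) ⟨
  + (N ℕ.* D) ℤ.+ + (A ²)          ≡⟨ ℤ.pos-+ (N ℕ.* D) (A ²) ⟨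
  + (N ℕ.* D ℕ.+ A ²)              ∎)
  where
  open ≡-Reasoning
  N = ∣ n ∣ ²
  D = d ²
  lemma : ∀ a N D → a ≡ N ℤ.* N ℤ.- N ℤ.* D ℤ.+ D ℤ.* D → N ℤ.* N ℤ.+ D ℤ.* D ≡ N ℤ.* D ℤ.+ a
  lemma a N D a≡ = trans (solve N D) (cong (λ a → N ℤ.* D ℤ.+ a) (sym a≡))
    where
    solve : ∀ N D → N ℤ.* N ℤ.+ D ℤ.* D ≡ N ℤ.* D ℤ.+ (N ℤ.* N ℤ.- N ℤ.* D ℤ.+ D ℤ.* D)
    solve = ℤ-Solver.solve-∀
  eq′ : + (A ²) ≡ + N ℤ.* + N ℤ.- + N ℤ.* + D ℤ.+ + D ℤ.* + D
  eq′ = trans eq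
    (cong₂ (λ n² d² → n² ℤ.* n² ℤ.- n² ℤ.* d² ℤ.+ d² ℤ.* d²) (i*i≡+∣i∣² n) (sym (ℤ.pos-* d d)))

fromℤ-quartic : ∀ n d →
  fromℤ (n ℤ.* n ℤ.* (n ℤ.* n) ℤ.- n ℤ.* n ℤ.* (d ℤ.* d) ℤ.+ d ℤ.* d ℤ.* (d ℤ.* d)) ≡
  fromℤ n * fromℤ n * (fromℤ n * fromℤ n) - fromℤ n * fromℤ n * (fromℤ d * fromℤ d) +
  fromℤ d * fromℤ d * (fromℤ d * fromℤ d)
fromℤ-quartic n d = begin
  fromℤ (n⁴ ℤ.- n²d² ℤ.+ d⁴)                     ≡⟨ fromℤ-+ (n⁴ ℤ.- n²d²) d⁴ ⟩
  fromℤ (n⁴ ℤ.- n²d²) + fromℤ d⁴                 ≡⟨ cong (_+ fromℤ d⁴) (fromℤ-+ n⁴ (ℤ.- n²d²)) ⟩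
  fromℤ n⁴ + fromℤ (ℤ.- n²d²) + fromℤ d⁴         ≡⟨ cong (λ x → fromℤ n⁴ + x + fromℤ d⁴) (fromℤ-neg n²d²) ⟩
  fromℤ n⁴ - fromℤ n²d² + fromℤ d⁴               ≡⟨ cong₂ (λ x y → x - y + fromℤ d⁴) (fromℤ-²*² n n) (fromℤ-²*² n d) ⟩
  N * N * (N * N) - N * N * (D * D) + fromℤ d⁴    ≡⟨ cong (λ z → N * N * (N * N) - N * N * (D * D) + z) (fromℤ-²*² d d) ⟩
  N * N * (N * N) - N * N * (D * D) + D * D * (D * D) ∎
  where
  open ≡-Reasoning
  N = fromℤ n
  D = fromℤ d
  n⁴ = n ℤ.* n ℤ.* (n ℤ.* n)
  n²d² = n ℤ.* n ℤ.* (d ℤ.* d)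
  d⁴ = d ℤ.* d ℤ.* (d ℤ.* d)
  fromℤ-²*² : ∀ i j → fromℤ (i ℤ.* i ℤ.* (j ℤ.* j)) ≡ fromℤ i * fromℤ i * (fromℤ j * fromℤ j)
  fromℤ-²*² i j = trans (fromℤ-* (i ℤ.* i) (j ℤ.* j)) (cong₂ _*_ (fromℤ-* i i) (fromℤ-* j j))

mkℚ*denominator : ∀ n dm .(c : Coprime ∣ n ∣ (suc dm)) → mkℚ n dm c * fromℤ (+ suc dm) ≡ fromℤ n
mkℚ*denominator n dm c = ℚ.toℚᵘ-injective
  (ℚᵘ.≃-trans (ℚ.toℚᵘ-homo-* (mkℚ n dm c) (fromℤ (+ suc dm)))
    (*≡* (trans (ℤ.*-identityʳ _) (cong (λ d → n ℤ.* + d) (sym (ℕ.*-identityʳ (suc dm)))))))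

trivial-square : ∀ n dm .(c : Coprime ∣ n ∣ (suc dm)) → ∣ n ∣ ≡ 0 ⊎ ∣ n ∣ ≡ suc dm →
                 mkℚ n dm c * mkℚ n dm c ≡ 0ℚ ⊎ mkℚ n dm c * mkℚ n dm c ≡ 1ℚ
trivial-square (+ zero)  zero     _ _           = inj₁ refl
trivial-square (+ zero)  (suc dm) c _           = case 0-coprimeTo-m⇒m≡1 (recompute c) of λ ()
trivial-square (+ suc n) _        _ (inj₁ ())
trivial-square -[1+ n ]  _        _ (inj₁ ())
trivial-square (+ suc n) zero     _ (inj₂ refl) = inj₂ refl
trivial-square -[1+ n ]  zero     _ (inj₂ refl) = inj₂ refl
trivial-square (+ suc n) (suc dm) c (inj₂ refl) = case recompute c (∣-refl , ∣-refl) of λ ()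
trivial-square -[1+ n ]  (suc dm) c (inj₂ refl) = case recompute c (∣-refl , ∣-refl) of λ ()

opaque
  rational-quartic-square⇒Quartic : ∀ n dm .(c : Coprime ∣ n ∣ (suc dm)) (w : ℚ) →
    let r = mkℚ n dm c in w * w ≡ r * r * (r * r) - r * r + 1ℚ → ∃[ A ] Quartic ∣ n ∣ (suc dm) A
  rational-quartic-square⇒Quartic n dm c w w²≡ =
    let (A , M≡A²) = square≡fromℤ⇒square q M q²≡M
    in A , ℤ-quartic⇒Quartic n (suc dm) A (sym M≡A²)
    where
    open ≡-Reasoning
    open +-*-Solver
    r N D q : ℚ
    r = mkℚ n dm c
    N = fromℤ n
    D = fromℤ (+ suc dm)
    q = w * (D * D)
    M : ℤ
    M = n ℤ.* n ℤ.* (n ℤ.* n) ℤ.- n ℤ.* n ℤ.* (+ suc dm ℤ.* + suc dm) ℤ.+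
        + suc dm ℤ.* + suc dm ℤ.* (+ suc dm ℤ.* + suc dm)
    q²≡M : q * q ≡ fromℤ M
    q²≡M = begin
      q * q                                                             ≡⟨ identity₁ w D ⟩
      w * w * (D * D * (D * D))                                         ≡⟨ cong (_* (D * D * (D * D))) w²≡ ⟩
      (r * r * (r * r) - r * r + 1ℚ) * (D * D * (D * D))                ≡⟨ identity₂ r D ⟩
      (r * D) * (r * D) * ((r * D) * (r * D)) - (r * D) * (r * D) * (D * D) + D * D * (D * D)
        ≡⟨ cong (λ x → x * x * (x * x) - x * x * (D * D) + D * D * (D * D)) (mkℚ*denominator n dm c) ⟩
      N * N * (N * N) - N * N * (D * D) + D * D * (D * D)               ≡⟨ fromℤ-quartic n (+ suc dm) ⟨
      fromℤ M                                                           ∎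
      where
      identity₁ : ∀ w D → (w * (D * D)) * (w * (D * D)) ≡ w * w * (D * D * (D * D))
      identity₁ = solve 2 (λ w D → (w :* (D :* D)) :* (w :* (D :* D)) := w :* w :* (D :* D :* (D :* D))) refl
      identity₂ : ∀ r D → (r * r * (r * r) - r * r + 1ℚ) * (D * D * (D * D)) ≡
                  (r * D) * (r * D) * ((r * D) * (r * D)) - (r * D) * (r * D) * (D * D) + D * D * (D * D)
      identity₂ = solve 2 (λ r D → (r :* r :* (r :* r) :- r :* r :+ con 1ℚ) :* (D :* D :* (D :* D)) :=
        (r :* D) :* (r :* D) :* ((r :* D) :* (r :* D)) :- (r :* D) :* (r :* D) :* (D :* D) :+ D :* D :* (D :* D)) refl

quartic-square⇒¬square : ∀ L → L ≢ 0ℚ → L ≢ 1ℚ → IsSquare (L * L - L + 1ℚ) → ¬ IsSquare L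
quartic-square⇒¬square L L≢0 L≢1 (w , w²≡) (mkℚ n dm c , refl)
  with A , quartic ← rational-quartic-square⇒Quartic n dm c w w²≡
  with trivial-square n dm c (quartic-trivial {z = A} (recompute c) (s≤s z≤n) quartic)
... | inj₁ r²≡0 = L≢0 r²≡0
... | inj₂ r²≡1 = L≢1 r²≡1

lemma3p4 : (L : ℚ) → L ≢ 0ℚ → L ≢ 1ℚ → IsSquare (L * L - L + 1ℚ)
    → ¬ IsSquare L × ¬ IsSquare (1ℚ - L)
lemma3p4 L L≢0 L≢1 square =
  quartic-square⇒¬square L L≢0 L≢1 square ,
  quartic-square⇒¬square (1ℚ - L) (λ 1-L≡0 → L≢1 (trans (involution L) (cong (λ x → 1ℚ - x) 1-L≡0)))
    (λ 1-L≡1 → L≢0 (trans (involution L) (cong (λ x → 1ℚ - x) 1-L≡1))) (subst IsSquare (sym (symmetry L)) square)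
  where
  open +-*-Solver
  involution : ∀ L → L ≡ 1ℚ - (1ℚ - L)
  involution = solve 1 (λ L → L := con 1ℚ :- (con 1ℚ :- L)) refl
  symmetry : ∀ L → (1ℚ - L) * (1ℚ - L) - (1ℚ - L) + 1ℚ ≡ L * L - L + 1ℚ
  symmetry = solve 1 (λ L → (con 1ℚ :- L) :* (con 1ℚ :- L) :- (con 1ℚ :- L) :+ con 1ℚ := L :* L :- L :+ con 1ℚ) refl
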